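{- Let $\Sigma=\{\mathsf{or},\mathsf{p}\}$ consist of two binary operators, and let $\mathcal{E}\subseteq(T\mathbb{N})^2$ be the smallest complete single-valued algebraic relation containing (in both directions) the equations $\mathsf{or}(x,x)=x$, $\mathsf{or}(x,y)=\mathsf{or}(y,x)$, $\mathsf{or}(x,\mathsf{or}(y,z))=\mathsf{or}(\mathsf{or}(x,y),z)$, $\mathsf{p}(x,x)=x$, $\mathsf{p}(x,y)=\mathsf{p}(y,x)$, $\mathsf{p}(\mathsf{p}(x,y),\mathsf{p}(z,w))=\mathsf{p}(\mathsf{p}(x,z),\mathsf{p}(y,w))$, $\mu x.\mathsf{p}(y,x)=y$, and $\mathsf{p}(x,\mathsf{or}(y,z))=\mathsf{or}(\mathsf{p}(x,y),\mathsf{p}(x,z))$, where $x,y,z,w$ are distinct variables (leaves $\langle n\rangle$ with distinct $n\in\mathbb{N}$) and $\mu x.\mathsf{p}(y,x)$ denotes the infinite tree $t$ with $t=\mathsf{p}(y,t)$. Then $\mathcal{E}$ contains the equation $\mathsf{p}(\mathsf{or}(x,y),\mathsf{or}(x,z))=\mathsf{or}(x,\mathsf{p}(y,z))$, i.e. both $(\mathsf{p}(\mathsf{or}(x,y),\mathsf{or}(x,z)),\mathsf{or}(x,\mathsf{p}(y,z)))$ and its reverse lie in $\mathcal{E}$, for distinct variables $x,y,z$.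
   Context: For a set $X$, $TX$ is the set of possibly infinite-depth trees with leaves $\bot$, $\top$, or $\langle x\rangle$ ($x\in X$), and binary internal nodes labelled $\mathsf{or}$ or $\mathsf{p}$. $T$ is a monad with $\eta(x)=\langle x\rangle$, $Tf$ relabelling leaves, $\mu$ substituting trees at leaves, and $f^*:=\mu\circ Tf$. Tree order $\le_{T\mathbb{N}}$ ($\mathbb{N}$ discrete): the largest relation $R$ such that $s\,R\,t$ implies $s=\bot$, or $t=\top$, or $s=t=\langle n\rangle$, or $s=\sigma(s_1,s_2)$, $t=\sigma(t_1,t_2)$ with the same operator and $s_i\,R\,t_i$; $T\mathbb{N}$ is $\omega$-complete with suprema $\bigvee$. An algebraic relation $\mathcal{E}\subseteq(T\mathbb{N})^2$ (write $a\,\mathcal{E}\,b$) is complete if it is reflexive, transitive, substitutional ($a\,\mathcal{E}\,b\Rightarrow f^*(a)\,\mathcal{E}\,f^*(b)$ for $f:\mathbb{N}\to T\mathbb{N}$), compositional ($a\,\mathcal{E}\,b$ and $f(n)\,\mathcal{E}\,g(n)$ for all $n$ imply $f^*(a)\,\mathcal{E}\,g^*(b)$), ordered ($a\le_{T\mathbb{N}}b\Rightarrow a\,\mathcal{E}\,b$) and admissible (for ascending $(a_n),(b_n)$ with $a_n\,\mathcal{E}\,b_n$, $\bigvee a_n\,\mathcal{E}\,\bigvee b_n$). It is single-valued if, for all $a,b$: $f^*(a)\,\mathcal{E}\,f^*(b)$ for all $f:\mathbb{N}\to\{\bot,\langle 0\rangle\}$ implies $a\,\mathcal{E}\,b$.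 An equation $a=b$ belongs to $\mathcal{E}$ when both $(a,b)$ and $(b,a)$ do. -}

module Defs where

open import Data.Nat using (ℕ; suc)
open import Data.Bool using (Bool; true; false)
open import Data.Product using (_×_)
open import Data.List using (List; []; _∷_)
open import Relation.Binary.PropositionalEquality using (_≡_)

data Op : Set where
  or p : Op

data Label : Set where
  bot  : Label
  top  : Label
  leaf : ℕ → Label
  nd   : Op → Label

-- Positions: finite paths from the root (false = left child, true = right child)
Pos : Set
Pos = List Bool

-- T ℕ : possibly infinite-depth trees, represented by their labelling
-- function on positions.  Labels at positions below a leaf (⊥, ⊤, ⟨n⟩)
-- are irrelevant junk; the tree order below only inspects reachable positions.
TN : Set
TN = Pos → Label

child : Bool → TN → TN
child b t π = t (b ∷ π)

⊥T ⊤T : TN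
⊥T _ = bot
⊤T _ = top

⟨_⟩ : ℕ → TN
⟨ n ⟩ _ = leaf n

node : Op → TN → TN → TN
node σ s t []           = nd σ
node σ s t (false ∷ π)  = s π
node σ s t (true ∷ π)   = t π

OR P : TN → TN → TN
OR = node or
P  = node p

-- Kleisli extension f* = μ ∘ T f  (substitute f n at every leaf ⟨n⟩)
_* : (ℕ → TN) → TN → TN
(f *) t π with t []
(f *) t π        | leaf n = f n π
(f *) t []       | l      = l
(f *) t (b ∷ π)  | nd σ   = (f *) (child b t) π
(f *) t (b ∷ π)  | bot    = bot
(f *) t (b ∷ π)  | top    = top

-- Tree order ≤_{TN}: the largest relation R with  s R t  ⇒  s = ⊥, or t = ⊤,
-- or s = t = ⟨n⟩, or s = σ(s₁,s₂), t = σ(t₁,t₂) with sᵢ R tᵢ.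
-- Unfolded: at every position reached jointly through internal nodes with
-- the same operator in s and t, the root labels are locally related.
data LocalLe : Label → Label → Set where
  bot≤  : ∀ {l} → LocalLe bot l
  ≤top  : ∀ {l} → LocalLe l top
  leaf≤ : ∀ {n} → LocalLe (leaf n) (leaf n)
  nd≤   : ∀ {σ} → LocalLe (nd σ) (nd σ)

data JointReach (s t : TN) : Pos → Set where
  here  : JointReach s t []
  there : ∀ {σ b π} → s [] ≡ nd σ → t [] ≡ nd σ →
          JointReach (child b s) (child b t) π → JointReach s t (b ∷ π)

_≤T_ : TN → TN → Set
s ≤T t = ∀ π → JointReach s t π → LocalLe (s π) (t π)

IsSup : (ℕ → TN) → TN → Set
IsSup c s = (∀ n → c n ≤T s) × (∀ u → (∀ n → c n ≤T u) → s ≤T u)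

Ascending : (ℕ → TN) → Set
Ascending c = ∀ n → c n ≤T c (suc n)

Rel : Set₁
Rel = TN → TN → Set

record Complete (E : Rel) : Set where
  field
    reflexive     : ∀ a → E a a
    transitive    : ∀ a b c → E a b → E b c → E a c
    substitutional : ∀ a b (f : ℕ → TN) → E a b → E ((f *) a) ((f *) b)
    compositional : ∀ a b (f g : ℕ → TN) → E a b → (∀ n → E (f n) (g n)) →
                    E ((f *) a) ((g *) b)
    ordered       : ∀ a b → a ≤T b → E a b
    admissible    : ∀ (a b : ℕ → TN) (a∞ b∞ : TN) →
                    Ascending a → Ascending b → (∀ n → E (a n) (b n)) →
                    IsSup a a∞ → IsSup b b∞ → E a∞ b∞

-- maps ℕ → {⊥, ⟨0⟩}, encoded by Bool
botOrZero : (ℕ → Bool) → ℕ → TN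
botOrZero f n with f n
... | true  = ⟨ 0 ⟩
... | false = ⊥T

SingleValued : Rel → Set
SingleValued E = ∀ a b → (∀ (f : ℕ → Bool) →
  E ((botOrZero f *) a) ((botOrZero f *) b)) → E a b

HasEq : Rel → TN → TN → Set
HasEq E a b = E a b × E b a

x y z w : TN
x = ⟨ 0 ⟩
y = ⟨ 1 ⟩
z = ⟨ 2 ⟩
w = ⟨ 3 ⟩

μPy : TN
μPy []           = nd p
μPy (false ∷ π)  = leaf 1
μPy (true ∷ π)   = μPy π

ContainsAxioms : Rel → Set
ContainsAxioms E =
  HasEq E (OR x x) x ×
  HasEq E (OR x y) (OR y x) ×
  HasEq E (OR x (OR y z)) (OR (OR x y) z) ×
  HasEq E (P x x) x ×
  HasEq E (P x y) (P y x) ×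
  HasEq E (P (P x y) (P z w)) (P (P x z) (P y w)) ×
  HasEq E μPy y ×
  HasEq E (P x (OR y z)) (OR (P x y) (P x z))

module Submission where

-- Single-valuedness reduces the equation
--   p(or(x,y), or(x,z)) = or(x, p(y,z))
-- to its instances under all substitutions of ⊥ and ⟨0⟩ for the three
-- variables.  Since only two values are available, two of the three
-- substituted trees coincide, and each of the three resulting shapes is
-- an equational consequence of idempotence of or and p, commutativity
-- of p, and left distributivity of p over or:
--   * y = z :  p(or(x,y), or(x,y)) = or(x,y) = or(x, p(y,y));
--   * x = y :  p(or(x,x), or(x,z)) = p(x, or(x,z)) = or(p(x,x), p(x,z))
--                                  = or(x, p(x,z));
--   * x = z :  the previous case with both sides commuted under p.
-- The file first shows that every complete relation contains pointwise
-- equality of trees and that its symmetric part is a congruence closed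
-- under substitution, then derives the needed instances of the axioms,
-- the three shapes, and finally the theorem.

open import Defs
open import Data.Nat using (ℕ; zero; suc)
open import Data.Bool using (Bool; true; false)
open import Data.Product using (_,_; proj₁; proj₂)
open import Data.List using ([]; _∷_)
open import Function using (_∘_)
open import Relation.Binary.Bundles using (Setoid)
open import Relation.Binary.Structures using (IsEquivalence)
open import Relation.Binary.PropositionalEquality using (_≡_; refl; sym; trans)
import Relation.Binary.Reasoning.Setoid as SetoidReasoning

_≗_ : TN → TN → Set
a ≗ b = ∀ π → a π ≡ b π

≗-sym : ∀ {a b} → a ≗ b → b ≗ a
≗-sym e π = sym (e π)

≗-trans : ∀ {a b c} → a ≗ b → b ≗ c → a ≗ c
≗-trans e e′ π = trans (e π) (e′ π)

node-cong : ∀ σ {a a′ b b′} → a ≗ a′ → b ≗ b′ → node σ a b ≗ node σ a′ b′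
node-cong σ e e′ []          = refl
node-cong σ e e′ (false ∷ π) = e π
node-cong σ e e′ (true ∷ π)  = e′ π

*-node : ∀ (f : ℕ → TN) σ s t → (f *) (node σ s t) ≗ node σ ((f *) s) ((f *) t)
*-node f σ s t []          = refl
*-node f σ s t (false ∷ π) = refl
*-node f σ s t (true ∷ π)  = refl

LocalLe-refl : ∀ l → LocalLe l l
LocalLe-refl bot      = bot≤
LocalLe-refl top      = ≤top
LocalLe-refl (leaf n) = leaf≤
LocalLe-refl (nd σ)   = nd≤

≗⇒≤T : ∀ {a b} → a ≗ b → a ≤T b
≗⇒≤T {a} {b} e π _ rewrite e π = LocalLe-refl (b π)

assign : TN → TN → TN → ℕ → TN
assign a b c zero          = a
assign a b c (suc zero)    = b
assign a b c (suc (suc _)) = c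

twoValued : Bool → TN
twoValued true  = ⟨ 0 ⟩
twoValued false = ⊥T

botOrZero≗twoValued : ∀ f n → botOrZero f n ≗ twoValued (f n)
botOrZero≗twoValued f n π with f n
... | true  = refl
... | false = refl

module Congruence (E : Rel) (C : Complete E) where
  open Complete C

  infix 4 _≋_
  _≋_ : TN → TN → Set
  a ≋ b = HasEq E a b

  ≋-isEquivalence : IsEquivalence _≋_
  ≋-isEquivalence = record
    { refl  = λ {a} → reflexive a , reflexive a
    ; sym   = λ (e , e′) → e′ , e
    ; trans = λ {a} {b} {c} (e₁ , e₂) (e₃ , e₄) →
                transitive a b c e₁ e₃ , transitive c b a e₄ e₂
    }

  ≋-setoid : Setoid _ _
  ≋-setoid = record { isEquivalence = ≋-isEquivalence }

  open IsEquivalence ≋-isEquivalence public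
    using () renaming (refl to ≋-refl; trans to ≋-trans)

  ≗⇒≋ : ∀ {a b} → a ≗ b → a ≋ b
  ≗⇒≋ {a} {b} e = ordered a b (≗⇒≤T e) , ordered b a (≗⇒≤T (≗-sym e))

  ≋-resp-≗ : ∀ {a a′ b b′} → a ≗ a′ → b ≗ b′ → a ≋ b → a′ ≋ b′
  ≋-resp-≗ ea eb h = ≋-trans (≗⇒≋ (≗-sym ea)) (≋-trans h (≗⇒≋ eb))

  instance≋ : ∀ (f : ℕ → TN) {a b a′ b′} →
              (f *) a ≗ a′ → (f *) b ≗ b′ → a ≋ b → a′ ≋ b′
  instance≋ f ea eb (e , e′) =
    ≋-resp-≗ ea eb (substitutional _ _ f e , substitutional _ _ f e′)

  -- Compositionality, applied to the term σ(x,y), makes every binary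
  -- operator a congruence.
  node-cong≋ : ∀ σ {s s′ t t′} → s ≋ s′ → t ≋ t′ → node σ s t ≋ node σ s′ t′
  node-cong≋ σ {s} {s′} {t} {t′} (s⊑s′ , s′⊑s) (t⊑t′ , t′⊑t) =
    ≋-resp-≗ (*-node (assign s t ⊥T) σ x y) (*-node (assign s′ t′ ⊥T) σ x y)
      ( compositional (node σ x y) (node σ x y) (assign s t ⊥T) (assign s′ t′ ⊥T)
          (reflexive _) forward
      , compositional (node σ x y) (node σ x y) (assign s′ t′ ⊥T) (assign s t ⊥T)
          (reflexive _) backward )
    where
    forward : ∀ n → E (assign s t ⊥T n) (assign s′ t′ ⊥T n)
    forward zero          = s⊑s′
    forward (suc zero)    = t⊑t′
    forward (suc (suc _)) = reflexive ⊥T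
    backward : ∀ n → E (assign s′ t′ ⊥T n) (assign s t ⊥T n)
    backward zero          = s′⊑s
    backward (suc zero)    = t′⊑t
    backward (suc (suc _)) = reflexive ⊥T

module Consequences (E : Rel) (C : Complete E) (A : ContainsAxioms E) where
  open Congruence E C
  open SetoidReasoning ≋-setoid

  or-idem : ∀ a → OR a a ≋ a
  or-idem a = instance≋ (assign a ⊥T ⊥T) (*-node _ or x x) (λ _ → refl) (proj₁ A)

  p-idem : ∀ a → P a a ≋ a
  p-idem a = instance≋ (assign a ⊥T ⊥T) (*-node _ p x x) (λ _ → refl)
               (proj₁ (proj₂ (proj₂ (proj₂ A))))

  p-comm : ∀ a b → P a b ≋ P b a
  p-comm a b = instance≋ (assign a b ⊥T) (*-node _ p x y) (*-node _ p y x)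
                 (proj₁ (proj₂ (proj₂ (proj₂ (proj₂ A)))))

  p-distrib-or : ∀ a b c → P a (OR b c) ≋ OR (P a b) (P a c)
  p-distrib-or a b c =
    instance≋ f
      (≗-trans (*-node f p x (OR y z)) (node-cong p (λ _ → refl) (*-node f or y z)))
      (≗-trans (*-node f or (P x y) (P x z))
               (node-cong or (*-node f p x y) (*-node f p x z)))
      (proj₂ (proj₂ (proj₂ (proj₂ (proj₂ (proj₂ (proj₂ A)))))))
    where f = assign a b c

  diagonal : ∀ a b → P (OR a b) (OR a b) ≋ OR a (P b b)
  diagonal a b = begin
    P (OR a b) (OR a b)  ≈⟨ p-idem (OR a b) ⟩
    OR a b               ≈⟨ node-cong≋ or ≋-refl (p-idem b) ⟨
    OR a (P b b)         ∎

  absorbLeft : ∀ a c → P (OR a a) (OR a c) ≋ OR a (P a c)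
  absorbLeft a c = begin
    P (OR a a) (OR a c)      ≈⟨ node-cong≋ p (or-idem a) ≋-refl ⟩
    P a (OR a c)             ≈⟨ p-distrib-or a a c ⟩
    OR (P a a) (P a c)       ≈⟨ node-cong≋ or (p-idem a) ≋-refl ⟩
    OR a (P a c)             ∎

  -- Exchanging the second and third argument (reduces x = z to x = y).
  swapArgs : ∀ a b c → P (OR a b) (OR a c) ≋ OR a (P b c) →
             P (OR a c) (OR a b) ≋ OR a (P c b)
  swapArgs a b c h = begin
    P (OR a c) (OR a b)  ≈⟨ p-comm (OR a c) (OR a b) ⟩
    P (OR a b) (OR a c)  ≈⟨ h ⟩
    OR a (P b c)         ≈⟨ node-cong≋ or ≋-refl (p-comm b c) ⟩
    OR a (P c b)         ∎

  -- Among three booleans two coincide, so every two-valued instance of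
  -- the target equation has one of the shapes above.
  twoValuedInstance : ∀ i j k →
    P (OR (twoValued i) (twoValued j)) (OR (twoValued i) (twoValued k))
      ≋ OR (twoValued i) (P (twoValued j) (twoValued k))
  twoValuedInstance i false false = diagonal (twoValued i) ⊥T
  twoValuedInstance i true  true  = diagonal (twoValued i) ⟨ 0 ⟩
  twoValuedInstance false false true  = absorbLeft ⊥T ⟨ 0 ⟩
  twoValuedInstance true  true  false = absorbLeft ⟨ 0 ⟩ ⊥T
  twoValuedInstance false true  false = swapArgs ⊥T ⊥T ⟨ 0 ⟩ (absorbLeft ⊥T ⟨ 0 ⟩)
  twoValuedInstance true  false true  = swapArgs ⟨ 0 ⟩ ⟨ 0 ⟩ ⊥T (absorbLeft ⟨ 0 ⟩ ⊥T)

*-lhs : ∀ (f : ℕ → TN) → (f *) (P (OR x y) (OR x z)) ≗ P (OR (f 0) (f 1)) (OR (f 0) (f 2))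
*-lhs f = ≗-trans (*-node f p (OR x y) (OR x z))
                  (node-cong p (*-node f or x y) (*-node f or x z))

*-rhs : ∀ (f : ℕ → TN) → (f *) (OR x (P y z)) ≗ OR (f 0) (P (f 1) (f 2))
*-rhs f = ≗-trans (*-node f or x (P y z)) (node-cong or (λ _ → refl) (*-node f p y z))

mainTheorem11 : (E : Rel) → Complete E → SingleValued E → ContainsAxioms E →
    HasEq E (P (OR x y) (OR x z)) (OR x (P y z))
mainTheorem11 E C SV A = SV L R (proj₁ ∘ instanceAt) , SV R L (proj₂ ∘ instanceAt)
  where
  open Congruence E C
  open Consequences E C A
  L R : TN
  L = P (OR x y) (OR x z)
  R = OR x (P y z)
  instanceAt : ∀ f → (botOrZero f *) L ≋ (botOrZero f *) R
  instanceAt f =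
    ≋-resp-≗ (≗-sym (≗-trans (*-lhs g) (node-cong p (node-cong or (b 0) (b 1))
                                                    (node-cong or (b 0) (b 2)))))
             (≗-sym (≗-trans (*-rhs g) (node-cong or (b 0) (node-cong p (b 1) (b 2)))))
             (twoValuedInstance (f 0) (f 1) (f 2))
    where
    g : ℕ → TN
    g = botOrZero f
    b : ∀ n → g n ≗ twoValued (f n)
    b = botOrZero≗twoValued f
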